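{- For all $n \ge 1$, there exists a (constructive) bijection between $\mathcal{P}_n(132)$ and the set of tilings of a $1\times(n-1)$ rectangle with tiles of size $1\times 1$ and $1\times 2$, in which each $1\times 1$ tile is colored either red or blue.
   Context: $S_n$ is the set of permutations of $\{1,\dots,n\}$ in one-line notation. A permutation avoids a pattern $\sigma\in S_k$ if it has no subsequence of length $k$ whose entries are in the same relative order as $\sigma$. $\mathcal{P}_n(132)$ denotes the set of two-stack sortable permutations in $S_n$ avoiding $132$; equivalently, the set of permutations in $S_n$ avoiding each of $132$, $2341$, $3241$. (For $n=1$ the rectangle is empty and has exactly one tiling.) -}

module Defs where

open import Data.Nat using (ℕ; zero; suc; _+_; _<ᵇ_; _≡ᵇ_)
open import Data.Bool using (Bool; true; false; _∧_; _∨_; not; T)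
open import Data.List using (List; []; _∷_; map; length)
open import Data.Bool.ListAction using (all; any)
open import Data.Fin using (Fin; toℕ)
open import Data.Vec using (Vec; toList)
open import Data.Product using (Σ)

subseqs : {A : Set} → ℕ → List A → List (List A)
subseqs zero xs = [] ∷ []
subseqs (suc k) [] = []
subseqs (suc k) (x ∷ xs) = map (x ∷_) (subseqs k xs) Data.List.++ subseqs (suc k) xs

sameOrderHead : ℕ → ℕ → List ℕ → List ℕ → Bool
sameOrderHead x y [] [] = true
sameOrderHead x y (a ∷ as) (b ∷ bs) =
  (not ((x <ᵇ a) Data.Bool.xor (y <ᵇ b))) ∧ sameOrderHead x y as bs
sameOrderHead x y _ _ = false

sameOrder : List ℕ → List ℕ → Bool
sameOrder [] [] = true
sameOrder (x ∷ xs) (y ∷ ys) = sameOrderHead x y xs ys ∧ sameOrder xs ys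
sameOrder _ _ = false

contains : List ℕ → List ℕ → Bool
contains w σ = any (λ s → sameOrder s σ) (subseqs (length σ) w)

avoids : List ℕ → List ℕ → Bool
avoids w σ = not (contains w σ)

distinct : List ℕ → Bool
distinct [] = true
distinct (x ∷ xs) = all (λ y → not (x ≡ᵇ y)) xs ∧ distinct xs

-- one-line notation of a permutation of {1..n}, values encoded as Fin n (0-based)
oneLine : {n : ℕ} → Vec (Fin n) n → List ℕ
oneLine v = map toℕ (toList v)

-- S_n : vectors of length n with pairwise distinct entries in Fin n
-- P_n(132) : two-stack sortable 132-avoiders = avoid 132, 2341, 3241
isP132 : {n : ℕ} → Vec (Fin n) n → Bool
isP132 v = distinct (oneLine v)
         ∧ avoids (oneLine v) (1 ∷ 3 ∷ 2 ∷ [])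
         ∧ avoids (oneLine v) (2 ∷ 3 ∷ 4 ∷ 1 ∷ [])
         ∧ avoids (oneLine v) (3 ∷ 2 ∷ 4 ∷ 1 ∷ [])

P132 : ℕ → Set
P132 n = Σ (Vec (Fin n) n) (λ v → T (isP132 v))

data Tile : Set where
  red blue domino : Tile

tileLen : Tile → ℕ
tileLen red = 1
tileLen blue = 1
tileLen domino = 2

totalLen : List Tile → ℕ
totalLen [] = 0
totalLen (t ∷ ts) = tileLen t + totalLen ts

Tiling : ℕ → Set
Tiling m = Σ (List Tile) (λ ts → T (totalLen ts ≡ᵇ m))

{-# OPTIONS --safe #-}
module Submission where

-- In a 132-avoiding permutation of {0, …, m} every entry before the maximum m exceeds every
-- entry after it.  If two entries a, b precede m and some c follows it, then a b m c is an
-- occurrence of 2341 (a < b) or of 3241 (b < a).  Hence for m ≥ 1 a member of 𝒫(132) has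
-- exactly one of the shapes  σ m,  m σ,  (m-1) m σ  with σ in 𝒫(132) of size m, m, m-1
-- respectively (in the last shape the entry before m is forced to be m-1, because everything
-- after it is smaller).  Conversely these three operations preserve avoidance: no forbidden
-- pattern ends with its largest entry, and in each of them the first entry is smaller than an
-- entry at distance at least two.  A red square, a blue square and a domino at the left end of
-- a tiling are mapped to the three operations, which gives the bijection.

open import Defs
open import Data.Bool using (Bool; true; false; not; T; _∧_)
open import Data.Bool.Properties using (T-∧; T-irrelevant)
open import Data.Empty using (⊥-elim)
open import Data.Fin using (Fin; toℕ; fromℕ<)
open import Data.Fin.Properties using (toℕ-fromℕ<; toℕ-injective; toℕ<n)
open import Data.List using (List; []; _∷_; _++_; [_]; length; map; drop)
open import Data.List.Membership.Propositional using (_∈_; _∉_; find; lose)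
open import Data.List.Membership.Propositional.Properties
  using (∈-++⁻; ∈-++⁺ˡ; ∈-++⁺ʳ; ∈-map⁻; ∈-map⁺; ∈-∃++)
open import Data.List.Properties
  using ( map-injective; length-map; length-++; length-++-sucʳ; ++-identityʳ
        ; ∷-injectiveˡ; ∷-injectiveʳ; ∷ʳ-injective; ∷ʳ-injectiveˡ)
open import Data.List.Relation.Binary.Sublist.Propositional
  using (_⊆_; []; _∷_; _∷ʳ_; minimum; ⊆-refl; ⊆-trans; from∈)
open import Data.List.Relation.Binary.Sublist.Propositional.Properties
  using (All-resp-⊆; drop-⊆; ++⁺; ++⁺ˡ)
open import Data.List.Relation.Unary.All as All using (All; []; _∷_)
import Data.List.Relation.Unary.All.Properties as All
open import Data.List.Relation.Unary.All.Properties using (all⁺; all⁻; All¬⇒¬Any; ¬Any⇒All¬)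
open import Data.List.Relation.Unary.AllPairs using ([]; _∷_)
open import Data.List.Relation.Unary.Any using (here; there)
open import Data.List.Relation.Unary.Any.Properties using (any⁺; any⁻)
open import Data.List.Relation.Unary.Unique.Propositional using (Unique)
import Data.List.Relation.Unary.Unique.Propositional.Properties as Unique
open import Data.Nat
  using (ℕ; zero; suc; _+_; _∸_; _<_; _≤_; _≥_; _<ᵇ_; _≟_; _<?_; z≤n; s≤s; z<s)
open import Data.Nat.Properties
  using ( <ᵇ-reflects-<; ≡⇒≡ᵇ; ≡ᵇ⇒≡; suc-injective; +-comm; 1+n≢n; 1+n≰n
        ; <-irrefl; <-trans; ≤-trans; <-≤-trans; ≤-<-trans
        ; <⇒≤; <⇒≢; <⇒≱; ≮⇒≥; ≤∧≢⇒<; ≤-pred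
        ; n<1+n; m<n⇒m<1+n; m≤n⇒m≤1+n; module ≤-Reasoning)
open import Data.List.Membership.DecPropositional _≟_ using (_∈?_)
open import Data.Product using (Σ; Σ-syntax; ∃-syntax; _×_; _,_; proj₁; proj₂)
open import Data.Product.Function.NonDependent.Propositional using (_×-⇔_)
open import Data.Sum using (_⊎_; inj₁; inj₂)
open import Data.Vec using (Vec; toList) renaming ([] to []ᵛ; _∷_ to _∷ᵛ_)
open import Data.Vec.Properties using (toList-injective; length-toList)
open import Data.Vec.Relation.Binary.Equality.Cast using (cast-is-id)
open import Function using (_∘_)
open import Function.Bundles using (_⇔_; mk⇔; Equivalence; _⤖_; mk⤖)
open import Function.Construct.Composition using (_⇔-∘_)
open import Function.Construct.Symmetry using (⤖-sym)
open import Function.Definitions using (Injective; Surjective)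
open import Relation.Binary.PropositionalEquality
  using (_≡_; _≢_; ≢-sym; refl; cong; cong₂; sym; trans; subst; module ≡-Reasoning)
open import Relation.Nullary using (¬_; yes; no; ofʸ; ofⁿ)
open import Relation.Unary using (_∪_)

T-not : ∀ b → T (not b) ⇔ (¬ T b)
T-not true  = mk⇔ (λ ()) (λ ¬t → ¬t _)
T-not false = mk⇔ (λ _ ()) (λ _ → _)

<ᵇ≡true : ∀ {m n} → m < n → (m <ᵇ n) ≡ true
<ᵇ≡true {m} {n} m<n with m <ᵇ n | <ᵇ-reflects-< m n
... | true  | _        = refl
... | false | ofⁿ m≮n = ⊥-elim (m≮n m<n)

<ᵇ≡false : ∀ {m n} → n ≤ m → (m <ᵇ n) ≡ false
<ᵇ≡false {m} {n} n≤m with m <ᵇ n | <ᵇ-reflects-< m n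
... | false | _        = refl
... | true  | ofʸ m<n = ⊥-elim (<⇒≱ m<n n≤m)

toList-surjective : ∀ {A : Set} {n} (xs : List A) → length xs ≡ n → ∃[ v ] toList {n = n} v ≡ xs
toList-surjective [] refl = []ᵛ , refl
toList-surjective (x ∷ xs) refl with v , v≡xs ← toList-surjective xs refl =
  x ∷ᵛ v , cong (x ∷_) v≡xs

⊆-++[]⁻ : ∀ {A : Set} (xs : List A) {x s} → s ⊆ xs ++ [ x ] →
          s ⊆ xs ⊎ ∃[ s′ ] s ≡ s′ ++ [ x ] × s′ ⊆ xs
⊆-++[]⁻ [] (_ ∷ʳ []) = inj₁ []
⊆-++[]⁻ [] (refl ∷ []) = inj₂ ([] , refl , [])
⊆-++[]⁻ (y ∷ xs) (.y ∷ʳ s⊆) with ⊆-++[]⁻ xs s⊆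
... | inj₁ s⊆xs               = inj₁ (y ∷ʳ s⊆xs)
... | inj₂ (s′ , eq , s′⊆xs) = inj₂ (s′ , eq , y ∷ʳ s′⊆xs)
⊆-++[]⁻ (y ∷ xs) (refl ∷ s⊆) with ⊆-++[]⁻ xs s⊆
... | inj₁ s⊆xs                 = inj₁ (refl ∷ s⊆xs)
... | inj₂ (s′ , refl , s′⊆xs) = inj₂ (y ∷ s′ , refl , refl ∷ s′⊆xs)

drop1-⊆ : ∀ {A : Set} {s : List A} {y xs} → s ⊆ y ∷ xs → drop 1 s ⊆ xs
drop1-⊆ (_ ∷ʳ s⊆xs) = ⊆-trans (drop-⊆ 1 _) s⊆xs
drop1-⊆ (refl ∷ s⊆xs) = s⊆xs

Unique-resp-⊆ : ∀ {A : Set} {xs ys : List A} → xs ⊆ ys → Unique ys → Unique xs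
Unique-resp-⊆ [] [] = []
Unique-resp-⊆ (_ ∷ʳ xs⊆ys) (_ ∷ u) = Unique-resp-⊆ xs⊆ys u
Unique-resp-⊆ (refl ∷ xs⊆ys) (fresh ∷ u) = All-resp-⊆ xs⊆ys fresh ∷ Unique-resp-⊆ xs⊆ys u

Unique-middle : ∀ {A : Set} (ys : List A) {x zs} → Unique (ys ++ x ∷ zs) → x ∉ ys ++ zs
Unique-middle [] (x-fresh ∷ _) = All¬⇒¬Any x-fresh
Unique-middle (y ∷ ys) (y-fresh ∷ _) (here refl) = All.lookup y-fresh (∈-++⁺ʳ ys (here refl)) refl
Unique-middle (y ∷ ys) (_ ∷ u) (there x∈) = Unique-middle ys u x∈

distinct⇔Unique : ∀ xs → T (distinct xs) ⇔ Unique xs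
distinct⇔Unique [] = mk⇔ (λ _ → []) (λ _ → _)
distinct⇔Unique (x ∷ xs) = mk⇔ to from
  where
  to : T (distinct (x ∷ xs)) → Unique (x ∷ xs)
  to t = let fresh , rest = Equivalence.to T-∧ t in
    All.map (λ t x≡y → Equivalence.to (T-not _) t (≡⇒≡ᵇ _ _ x≡y)) (all⁺ _ xs fresh)
    ∷ Equivalence.to (distinct⇔Unique xs) rest
  from : Unique (x ∷ xs) → T (distinct (x ∷ xs))
  from (fresh ∷ rest) = Equivalence.from T-∧
    ( all⁻ _ (All.map (λ x≢y → Equivalence.from (T-not _) (x≢y ∘ ≡ᵇ⇒≡ _ _)) fresh)
    , Equivalence.from (distinct⇔Unique xs) rest)

bounded-fresh : ∀ {m xs} → All (_< m) xs → All (m ≢_) xs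
bounded-fresh = All.map λ x<m → ≢-sym (<⇒≢ x<m)

bounded-∉ : ∀ {m xs} → All (_< m) xs → m ∉ xs
bounded-∉ = All¬⇒¬Any ∘ bounded-fresh

tighten-bound : ∀ {m xs} → m ∉ xs → All (_< suc m) xs → All (_< m) xs
tighten-bound m∉xs xs<1+m =
  All.zipWith (λ (x<1+m , m≢x) → ≤∧≢⇒< (≤-pred x<1+m) (≢-sym m≢x))
              (xs<1+m , ¬Any⇒All¬ _ m∉xs)

Unique-bounded⇒length≤ : ∀ n {xs} → Unique xs → All (_< n) xs → length xs ≤ n
Unique-bounded⇒length≤ zero [] [] = z≤n
Unique-bounded⇒length≤ (suc n) {xs} u xs<1+n with n ∈? xs
... | no n∉xs = m≤n⇒m≤1+n (Unique-bounded⇒length≤ n u (tighten-bound n∉xs xs<1+n))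
... | yes n∈xs with ys , zs , refl ← ∈-∃++ n∈xs = begin
  length (ys ++ n ∷ zs)   ≡⟨ length-++-sucʳ ys n zs ⟩
  suc (length (ys ++ zs)) ≤⟨ s≤s (Unique-bounded⇒length≤ n (Unique-resp-⊆ drop-n u) rest<n) ⟩
  suc n                   ∎
  where
  open ≤-Reasoning
  drop-n : ys ++ zs ⊆ ys ++ n ∷ zs
  drop-n = ++⁺ ⊆-refl (n ∷ʳ ⊆-refl)
  rest<n : All (_< n) (ys ++ zs)
  rest<n = tighten-bound (Unique-middle ys u) (All-resp-⊆ drop-n xs<1+n)

Occurs : (List ℕ → Set) → List ℕ → Set
Occurs P w = ∃[ s ] s ⊆ w × P s

Occurs-resp-⊆ : ∀ {P xs ys} → xs ⊆ ys → Occurs P xs → Occurs P ys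
Occurs-resp-⊆ xs⊆ys (s , s⊆xs , ps) = s , ⊆-trans s⊆xs xs⊆ys , ps

¬Occurs-∪ : ∀ {P Q w} → (¬ Occurs P w × ¬ Occurs Q w) ⇔ (¬ Occurs (P ∪ Q) w)
¬Occurs-∪ = mk⇔
  (λ (¬p , ¬q) → λ { (s , s⊆w , inj₁ ps) → ¬p (s , s⊆w , ps)
                    ; (s , s⊆w , inj₂ qs) → ¬q (s , s⊆w , qs) })
  (λ ¬pq → (λ (s , s⊆w , ps) → ¬pq (s , s⊆w , inj₁ ps))
         , (λ (s , s⊆w , qs) → ¬pq (s , s⊆w , inj₂ qs)))

∈-subseqs⇒⊆ : ∀ {A : Set} k (xs : List A) {s} → s ∈ subseqs k xs → s ⊆ xs
∈-subseqs⇒⊆ zero xs (here refl) = minimum xs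
∈-subseqs⇒⊆ (suc k) (x ∷ xs) s∈ with ∈-++⁻ (map (x ∷_) (subseqs k xs)) s∈
... | inj₁ s∈x∷ with _ , s′∈ , refl ← ∈-map⁻ (x ∷_) s∈x∷ =
  refl ∷ ∈-subseqs⇒⊆ k xs s′∈
... | inj₂ s∈ = x ∷ʳ ∈-subseqs⇒⊆ (suc k) xs s∈

⊆⇒∈-subseqs : ∀ {A : Set} {s xs : List A} → s ⊆ xs → s ∈ subseqs (length s) xs
⊆⇒∈-subseqs [] = here refl
⊆⇒∈-subseqs {s = []} (_ ∷ʳ _) = here refl
⊆⇒∈-subseqs {s = _ ∷ _} (_ ∷ʳ s⊆xs) = ∈-++⁺ʳ _ (⊆⇒∈-subseqs s⊆xs)
⊆⇒∈-subseqs (refl ∷ s⊆xs) = ∈-++⁺ˡ (∈-map⁺ _ (⊆⇒∈-subseqs s⊆xs))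

sameOrder-length : ∀ s σ → T (sameOrder s σ) → length s ≡ length σ
sameOrder-length [] [] _ = refl
sameOrder-length (_ ∷ s) (_ ∷ σ) t = cong suc (sameOrder-length s σ (proj₂ (Equivalence.to T-∧ t)))
sameOrder-length [] (_ ∷ _) ()
sameOrder-length (_ ∷ _) [] ()

-- A recogniser only needs to handle lists of the length of σ, which it receives as vectors.
module _ {P : List ℕ → Set} (σ : List ℕ)
         (P⇒sameOrder : ∀ {s} → P s → T (sameOrder s σ))
         (sameOrder⇒P : ∀ (v : Vec ℕ (length σ)) → T (sameOrder (toList v) σ) → P (toList v))
         where

  contains⇔Occurs : ∀ w → T (contains w σ) ⇔ Occurs P w
  contains⇔Occurs w = mk⇔ to from
    where
    to : T (contains w σ) → Occurs P w
    to t with s , s∈ , t′ ← find (any⁻ _ _ t)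
         with v , refl ← toList-surjective s (sameOrder-length s σ t′)
            = s , ∈-subseqs⇒⊆ (length σ) w s∈ , sameOrder⇒P v t′
    from : Occurs P w → T (contains w σ)
    from (s , s⊆w , ps) = any⁺ _ (lose s∈ (P⇒sameOrder ps))
      where
      s∈ : s ∈ subseqs (length σ) w
      s∈ = subst (λ k → s ∈ subseqs k w) (sameOrder-length s σ (P⇒sameOrder ps))
                 (⊆⇒∈-subseqs s⊆w)

  avoids⇔¬Occurs : ∀ w → T (avoids w σ) ⇔ (¬ Occurs P w)
  avoids⇔¬Occurs w = mk⇔
    (λ t occ → Equivalence.to (T-not _) t (Equivalence.from (contains⇔Occurs w) occ))
    (λ ¬occ → Equivalence.from (T-not _) (¬occ ∘ Equivalence.to (contains⇔Occurs w)))

-- `sameOrder` compares with `_<ᵇ_`, so a tie counts as a descent; the non-strict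
-- inequalities make these predicates exact translations of it.
data Is132 : List ℕ → Set where
  is132 : ∀ {a b c} → a < c → c ≤ b → Is132 (a ∷ b ∷ c ∷ [])

data Is2341 : List ℕ → Set where
  is2341 : ∀ {a b c d} → d ≤ a → a < b → b < c → Is2341 (a ∷ b ∷ c ∷ d ∷ [])

data Is3241 : List ℕ → Set where
  is3241 : ∀ {a b c d} → d ≤ b → b ≤ a → a < c → Is3241 (a ∷ b ∷ c ∷ d ∷ [])

Is132⇒sameOrder : ∀ {s} → Is132 s → T (sameOrder s (1 ∷ 3 ∷ 2 ∷ []))
Is132⇒sameOrder (is132 a<c c≤b)
  rewrite <ᵇ≡true (<-≤-trans a<c c≤b) | <ᵇ≡true a<c | <ᵇ≡false c≤b = _

sameOrder⇒Is132 : ∀ (v : Vec ℕ 3) → T (sameOrder (toList v) (1 ∷ 3 ∷ 2 ∷ [])) →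
                  Is132 (toList v)
sameOrder⇒Is132 (a ∷ᵛ b ∷ᵛ c ∷ᵛ []ᵛ) t
  with a <ᵇ b | a <ᵇ c | <ᵇ-reflects-< a c | b <ᵇ c | <ᵇ-reflects-< b c
... | true  | true  | ofʸ a<c | false | ofⁿ b≮c = is132 a<c (≮⇒≥ b≮c)
... | false | _     | _       | _     | _       = ⊥-elim t
... | true  | false | _       | _     | _       = ⊥-elim t
... | true  | true  | _       | true  | _       = ⊥-elim t

Is2341⇒sameOrder : ∀ {s} → Is2341 s → T (sameOrder s (2 ∷ 3 ∷ 4 ∷ 1 ∷ []))
Is2341⇒sameOrder (is2341 d≤a a<b b<c)
  rewrite <ᵇ≡true a<b | <ᵇ≡true (<-trans a<b b<c) | <ᵇ≡false d≤a | <ᵇ≡true b<c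
        | <ᵇ≡false (≤-trans d≤a (<⇒≤ a<b))
        | <ᵇ≡false (≤-trans d≤a (<⇒≤ (<-trans a<b b<c))) = _

sameOrder⇒Is2341 : ∀ (v : Vec ℕ 4) → T (sameOrder (toList v) (2 ∷ 3 ∷ 4 ∷ 1 ∷ [])) →
                   Is2341 (toList v)
sameOrder⇒Is2341 (a ∷ᵛ b ∷ᵛ c ∷ᵛ d ∷ᵛ []ᵛ) t
  with a <ᵇ b | <ᵇ-reflects-< a b | a <ᵇ c | a <ᵇ d | <ᵇ-reflects-< a d
     | b <ᵇ c | <ᵇ-reflects-< b c | b <ᵇ d | c <ᵇ d
... | true  | ofʸ a<b | true  | false | ofⁿ a≮d | true  | ofʸ b<c | false | false =
  is2341 (≮⇒≥ a≮d) a<b b<c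
... | false | _       | _     | _     | _       | _     | _       | _     | _     = ⊥-elim t
... | true  | _       | false | _     | _       | _     | _       | _     | _     = ⊥-elim t
... | true  | _       | true  | true  | _       | _     | _       | _     | _     = ⊥-elim t
... | true  | _       | true  | false | _       | false | _       | _     | _     = ⊥-elim t
... | true  | _       | true  | false | _       | true  | _       | true  | _     = ⊥-elim t
... | true  | _       | true  | false | _       | true  | _       | false | true  = ⊥-elim t

Is3241⇒sameOrder : ∀ {s} → Is3241 s → T (sameOrder s (3 ∷ 2 ∷ 4 ∷ 1 ∷ []))
Is3241⇒sameOrder (is3241 d≤b b≤a a<c)
  rewrite <ᵇ≡false b≤a | <ᵇ≡true a<c | <ᵇ≡false (≤-trans d≤b b≤a)
        | <ᵇ≡true (≤-<-trans b≤a a<c)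
        | <ᵇ≡false d≤b | <ᵇ≡false (≤-trans d≤b (≤-trans b≤a (<⇒≤ a<c))) = _

sameOrder⇒Is3241 : ∀ (v : Vec ℕ 4) → T (sameOrder (toList v) (3 ∷ 2 ∷ 4 ∷ 1 ∷ [])) →
                   Is3241 (toList v)
sameOrder⇒Is3241 (a ∷ᵛ b ∷ᵛ c ∷ᵛ d ∷ᵛ []ᵛ) t
  with a <ᵇ b | <ᵇ-reflects-< a b | a <ᵇ c | <ᵇ-reflects-< a c | a <ᵇ d
     | b <ᵇ c | b <ᵇ d | <ᵇ-reflects-< b d | c <ᵇ d
... | false | ofⁿ a≮b | true  | ofʸ a<c | false | true  | false | ofⁿ b≮d | false =
  is3241 (≮⇒≥ b≮d) (≮⇒≥ a≮b) a<c
... | true  | _       | _     | _       | _     | _     | _     | _       | _     = ⊥-elim t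
... | false | _       | false | _       | _     | _     | _     | _       | _     = ⊥-elim t
... | false | _       | true  | _       | true  | _     | _     | _       | _     = ⊥-elim t
... | false | _       | true  | _       | false | false | _     | _       | _     = ⊥-elim t
... | false | _       | true  | _       | false | true  | true  | _       | _     = ⊥-elim t
... | false | _       | true  | _       | false | true  | false | _       | true  = ⊥-elim t

Forbidden : List ℕ → Set
Forbidden = Is132 ∪ Is2341 ∪ Is3241

Avoiding : List ℕ → Set
Avoiding w = ¬ Occurs Forbidden w

avoids⇔Avoiding : ∀ w →
  T (avoids w (1 ∷ 3 ∷ 2 ∷ []) ∧ avoids w (2 ∷ 3 ∷ 4 ∷ 1 ∷ []) ∧ avoids w (3 ∷ 2 ∷ 4 ∷ 1 ∷ []))
  ⇔ Avoiding w
avoids⇔Avoiding w =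
  ¬Occurs-∪ ⇔-∘
    ((avoids132 ×-⇔ (¬Occurs-∪ ⇔-∘ ((avoids2341 ×-⇔ avoids3241) ⇔-∘ T-∧))) ⇔-∘ T-∧)
  where
  avoids132  = avoids⇔¬Occurs (1 ∷ 3 ∷ 2 ∷ []) Is132⇒sameOrder sameOrder⇒Is132 w
  avoids2341 = avoids⇔¬Occurs (2 ∷ 3 ∷ 4 ∷ 1 ∷ []) Is2341⇒sameOrder sameOrder⇒Is2341 w
  avoids3241 = avoids⇔¬Occurs (3 ∷ 2 ∷ 4 ∷ 1 ∷ []) Is3241⇒sameOrder sameOrder⇒Is3241 w

-- Adding a new maximum

FirstBelowLater : (List ℕ → Set) → Set
FirstBelowLater P = ∀ {a s} → P (a ∷ s) → ¬ All (_≤ a) (drop 1 s)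

LastNotMaximal : (List ℕ → Set) → Set
LastNotMaximal P = ∀ {s m} → P (s ++ [ m ]) → ¬ All (_< m) s

Forbidden-firstBelowLater : FirstBelowLater Forbidden
Forbidden-firstBelowLater (inj₁ (is132 a<c _))             (c≤a ∷ []) = <⇒≱ a<c c≤a
Forbidden-firstBelowLater (inj₂ (inj₁ (is2341 _ a<b b<c))) (c≤a ∷ _) = <⇒≱ (<-trans a<b b<c) c≤a
Forbidden-firstBelowLater (inj₂ (inj₂ (is3241 _ _ a<c)))   (c≤a ∷ _) = <⇒≱ a<c c≤a

Forbidden-lastNotMaximal : LastNotMaximal Forbidden
Forbidden-lastNotMaximal = lastNotMaximal refl
  where
  -- the index s ++ [ m ] does not unify with the constructors' indices, hence the equation
  lastNotMaximal : ∀ {t s m} → t ≡ s ++ [ m ] → Forbidden t → ¬ All (_< m) s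
  lastNotMaximal eq (inj₁ (is132 _ c≤b)) s<m
    with refl , refl ← ∷ʳ-injective (_ ∷ _ ∷ []) _ eq =
    <⇒≱ (All.lookup s<m (there (here refl))) c≤b
  lastNotMaximal eq (inj₂ (inj₁ (is2341 d≤a _ _))) s<m
    with refl , refl ← ∷ʳ-injective (_ ∷ _ ∷ _ ∷ []) _ eq =
    <⇒≱ (All.head s<m) d≤a
  lastNotMaximal eq (inj₂ (inj₂ (is3241 d≤b _ _))) s<m
    with refl , refl ← ∷ʳ-injective (_ ∷ _ ∷ _ ∷ []) _ eq =
    <⇒≱ (All.lookup s<m (there (here refl))) d≤b

module _ {P : List ℕ → Set} where

  ¬Occurs-++max : LastNotMaximal P → ∀ {m xs} → All (_< m) xs → ¬ Occurs P xs →
                  ¬ Occurs P (xs ++ [ m ])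
  ¬Occurs-++max lnm {xs = xs} xs<m ¬occ (s , s⊆ , ps) with ⊆-++[]⁻ xs s⊆
  ... | inj₁ s⊆xs                = ¬occ (s , s⊆xs , ps)
  ... | inj₂ (s′ , refl , s′⊆xs) = lnm ps (All-resp-⊆ s′⊆xs xs<m)

  ¬Occurs-max∷ : FirstBelowLater P → ∀ {m xs} → All (_< m) xs → ¬ Occurs P xs →
                 ¬ Occurs P (m ∷ xs)
  ¬Occurs-max∷ fbl xs<m ¬occ (s , _ ∷ʳ s⊆xs , ps) = ¬occ (s , s⊆xs , ps)
  ¬Occurs-max∷ fbl xs<m ¬occ (_ , refl ∷ s⊆xs , ps) =
    fbl ps (All-resp-⊆ (⊆-trans (drop-⊆ 1 _) s⊆xs) (All.map <⇒≤ xs<m))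

  ¬Occurs-max∷max∷ : FirstBelowLater P → ∀ {m xs} → All (_< m) xs → ¬ Occurs P xs →
                     ¬ Occurs P (m ∷ suc m ∷ xs)
  ¬Occurs-max∷max∷ fbl xs<m ¬occ (s , _ ∷ʳ s⊆ , ps) =
    ¬Occurs-max∷ fbl (All.map m<n⇒m<1+n xs<m) ¬occ (s , s⊆ , ps)
  ¬Occurs-max∷max∷ fbl xs<m ¬occ (_ , refl ∷ s⊆ , ps) =
    fbl ps (All-resp-⊆ (drop1-⊆ s⊆) (All.map <⇒≤ xs<m))

record IsP132 (n : ℕ) (xs : List ℕ) : Set where
  field
    length≡  : length xs ≡ n
    bounded  : All (_< n) xs
    unique   : Unique xs
    avoiding : Avoiding xs
open IsP132

IsP132-resp-⊆ : ∀ {n k xs ys} → ys ⊆ xs → length ys ≡ k → All (_< k) ys →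
                IsP132 n xs → IsP132 k ys
IsP132-resp-⊆ ys⊆xs len bnd p = record
  { length≡  = len
  ; bounded  = bnd
  ; unique   = Unique-resp-⊆ ys⊆xs (unique p)
  ; avoiding = avoiding p ∘ Occurs-resp-⊆ ys⊆xs
  }

IsP132-[] : IsP132 0 []
IsP132-[] = record
  { length≡  = refl
  ; bounded  = []
  ; unique   = []
  ; avoiding = λ { (_ , [] , inj₁ ()) ; (_ , [] , inj₂ (inj₁ ())) ; (_ , [] , inj₂ (inj₂ ())) }
  }

IsP132-++max : ∀ {m xs} → IsP132 m xs → IsP132 (suc m) (xs ++ [ m ])
IsP132-++max {m} {xs} p = record
  { length≡  = trans (length-++ xs) (trans (cong (_+ 1) (length≡ p)) (+-comm m 1))
  ; bounded  = All.++⁺ (All.map m<n⇒m<1+n (bounded p)) (n<1+n m ∷ [])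
  ; unique   = Unique.++⁺ (unique p) ([] ∷ [])
                 λ { (m∈xs , here refl) → bounded-∉ (bounded p) m∈xs }
  ; avoiding = ¬Occurs-++max Forbidden-lastNotMaximal (bounded p) (avoiding p)
  }

IsP132-max∷ : ∀ {m xs} → IsP132 m xs → IsP132 (suc m) (m ∷ xs)
IsP132-max∷ {m} p = record
  { length≡  = cong suc (length≡ p)
  ; bounded  = n<1+n m ∷ All.map m<n⇒m<1+n (bounded p)
  ; unique   = bounded-fresh (bounded p) ∷ unique p
  ; avoiding = ¬Occurs-max∷ Forbidden-firstBelowLater (bounded p) (avoiding p)
  }

IsP132-max∷max∷ : ∀ {m xs} → IsP132 m xs → IsP132 (suc (suc m)) (m ∷ suc m ∷ xs)
IsP132-max∷max∷ {m} p = record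
  { length≡  = cong (suc ∘ suc) (length≡ p)
  ; bounded  = m<n⇒m<1+n (n<1+n m) ∷ n<1+n (suc m) ∷ All.map (m<n⇒m<1+n ∘ m<n⇒m<1+n) (bounded p)
  ; unique   = (<⇒≢ (n<1+n m) ∷ bounded-fresh (bounded p))
             ∷ bounded-fresh (All.map m<n⇒m<1+n (bounded p)) ∷ unique p
  ; avoiding = ¬Occurs-max∷max∷ Forbidden-firstBelowLater (bounded p) (avoiding p)
  }

encode : List Tile → List ℕ
encode [] = [ 0 ]
encode (red ∷ ts)    = encode ts ++ [ suc (totalLen ts) ]
encode (blue ∷ ts)   = suc (totalLen ts) ∷ encode ts
encode (domino ∷ ts) = suc (totalLen ts) ∷ suc (suc (totalLen ts)) ∷ encode ts

encode-IsP132 : ∀ ts → IsP132 (suc (totalLen ts)) (encode ts)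
encode-IsP132 [] = IsP132-max∷ IsP132-[]
encode-IsP132 (red ∷ ts)    = IsP132-++max (encode-IsP132 ts)
encode-IsP132 (blue ∷ ts)   = IsP132-max∷ (encode-IsP132 ts)
encode-IsP132 (domino ∷ ts) = IsP132-max∷max∷ (encode-IsP132 ts)

-- Decomposition around the maximum

max∈ : ∀ {m xs} → IsP132 (suc m) xs → m ∈ xs
max∈ {m} {xs} p with m ∈? xs
... | yes m∈xs = m∈xs
... | no m∉xs  = ⊥-elim (1+n≰n (subst (_≤ m) (length≡ p)
                   (Unique-bounded⇒length≤ m (unique p) (tighten-bound m∉xs (bounded p)))))

module _ {m} (α β : List ℕ) (p : IsP132 (suc m) (α ++ m ∷ β)) where

  remove-max : IsP132 m (α ++ β)
  remove-max = IsP132-resp-⊆ drop-max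
    (suc-injective (trans (sym (length-++-sucʳ α m β)) (length≡ p)))
    (tighten-bound (Unique-middle α (unique p)) (All-resp-⊆ drop-max (bounded p)))
    p
    where
    drop-max : α ++ β ⊆ α ++ m ∷ β
    drop-max = ++⁺ ⊆-refl (m ∷ʳ ⊆-refl)

  prefix-above-suffix : All (λ x → All (_< x) β) α
  prefix-above-suffix =
    All.tabulate λ x∈α → All.tabulate λ y∈β → y<x (++⁺ (from∈ x∈α) (refl ∷ from∈ y∈β))
    where
    y<x : ∀ {x y} → x ∷ m ∷ y ∷ [] ⊆ α ++ m ∷ β → y < x
    y<x sub with Unique-resp-⊆ sub (unique p) | All-resp-⊆ sub (bounded p)
    ... | (_ ∷ x≢y ∷ []) ∷ _ | _ ∷ _ ∷ y<1+m ∷ [] =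
      ≤∧≢⇒< (≮⇒≥ λ x<y → avoiding p (_ , sub , inj₁ (is132 x<y (≤-pred y<1+m))))
            (≢-sym x≢y)

IsP132-one : ∀ {xs} → IsP132 1 xs → xs ≡ [ 0 ]
IsP132-one {_ ∷ []} p with bounded p
... | z<s ∷ [] = refl
IsP132-one {[]} p with () ← length≡ p
IsP132-one {_ ∷ _ ∷ _} p with () ← length≡ p

-- Without the maximum a ∷ β is in 𝒫(132) again, and its maximum k cannot lie in β, below a.
pred-before-max : ∀ {k a β} → IsP132 (suc (suc k)) (a ∷ suc k ∷ β) → a ≡ k
pred-before-max {k} {a} {β} p with remove-max (a ∷ []) β p | prefix-above-suffix (a ∷ []) β p
... | q | β<a ∷ [] with max∈ q | bounded q
...   | here k≡a  | _         = sym k≡a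
...   | there k∈β | a<1+k ∷ _ = ⊥-elim (<⇒≱ (All.lookup β<a k∈β) (≤-pred a<1+k))

max-preceded-by-two-is-last : ∀ {m} a b α c β → ¬ IsP132 (suc m) (a ∷ b ∷ α ++ m ∷ c ∷ β)
max-preceded-by-two-is-last {m} a b α c β p = avoiding p (_ , sub , forbidden)
  where
  sub : a ∷ b ∷ m ∷ c ∷ [] ⊆ a ∷ b ∷ α ++ m ∷ c ∷ β
  sub = refl ∷ refl ∷ ++⁺ˡ α (refl ∷ refl ∷ minimum β)
  forbidden : Forbidden (a ∷ b ∷ m ∷ c ∷ [])
  forbidden
    with bounded (remove-max (a ∷ b ∷ α) (c ∷ β) p) | prefix-above-suffix (a ∷ b ∷ α) (c ∷ β) p
  ... | a<m ∷ b<m ∷ _ | (c<a ∷ _) ∷ (c<b ∷ _) ∷ _ with a <? b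
  ...   | yes a<b = inj₂ (inj₁ (is2341 (<⇒≤ c<a) a<b b<m))
  ...   | no a≮b  = inj₂ (inj₂ (is3241 (<⇒≤ c<b) (≮⇒≥ a≮b) a<m))

data Decomposition : ℕ → List ℕ → Set where
  single : Decomposition 0 [ 0 ]
  red    : ∀ {m xs} → IsP132 (suc m) xs → Decomposition (suc m) (xs ++ [ suc m ])
  blue   : ∀ {m xs} → IsP132 (suc m) xs → Decomposition (suc m) (suc m ∷ xs)
  domino : ∀ {m xs} → IsP132 (suc m) xs → Decomposition (suc (suc m)) (suc m ∷ suc (suc m) ∷ xs)

decompose-around-max : ∀ {k} α β → IsP132 (suc (suc k)) (α ++ suc k ∷ β) →
                       Decomposition (suc k) (α ++ suc k ∷ β)
decompose-around-max α [] p = red (subst (IsP132 _) (++-identityʳ α) (remove-max α [] p))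
decompose-around-max [] β@(_ ∷ _) p = blue (remove-max [] β p)
decompose-around-max {zero} (a ∷ []) (c ∷ β) p
  with pred-before-max p | prefix-above-suffix (a ∷ []) (c ∷ β) p
... | refl | (() ∷ _) ∷ []
decompose-around-max {suc k} (a ∷ []) (c ∷ β) p
  with pred-before-max p | prefix-above-suffix (a ∷ []) (c ∷ β) p | remove-max (a ∷ []) (c ∷ β) p
... | refl | cβ<a ∷ [] | q =
  domino (IsP132-resp-⊆ (a ∷ʳ ⊆-refl) (suc-injective (length≡ q)) cβ<a q)
decompose-around-max (a ∷ b ∷ α) (c ∷ β) p = ⊥-elim (max-preceded-by-two-is-last a b α c β p)

decompose : ∀ m {xs} → IsP132 (suc m) xs → Decomposition m xs
decompose zero p with refl ← IsP132-one p = single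
decompose (suc k) p with α , β , refl ← ∈-∃++ (max∈ p) = decompose-around-max α β p

encode-surjective : ∀ m {xs} → IsP132 (suc m) xs → ∃[ ts ] totalLen ts ≡ m × encode ts ≡ xs
encode-surjective m p with decompose m p
... | single = [] , refl , refl
... | red {m′} q    with ts , refl , refl ← encode-surjective m′ q = red ∷ ts , refl , refl
... | blue {m′} q   with ts , refl , refl ← encode-surjective m′ q = blue ∷ ts , refl , refl
... | domino {m′} q with ts , refl , refl ← encode-surjective m′ q = domino ∷ ts , refl , refl

encode-totalLen : ∀ ts us → encode ts ≡ encode us → totalLen ts ≡ totalLen us
encode-totalLen ts us e = suc-injective (begin
  suc (totalLen ts)  ≡⟨ length≡ (encode-IsP132 ts) ⟨
  length (encode ts) ≡⟨ cong length e ⟩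
  length (encode us) ≡⟨ length≡ (encode-IsP132 us) ⟩
  suc (totalLen us)  ∎)
  where open ≡-Reasoning

totalLen-∷≢0 : ∀ t ts → totalLen (t ∷ ts) ≢ 0
totalLen-∷≢0 red    _ ()
totalLen-∷≢0 blue   _ ()
totalLen-∷≢0 domino _ ()

entry-before-last< : ∀ {m m′ xs ys} zs → All (_< m) xs → xs ++ [ m ] ≡ zs ++ m′ ∷ ys →
                     length zs < length xs → m′ < m
entry-before-last< [] (x<m ∷ _) e _ = subst (_< _) (∷-injectiveˡ e) x<m
entry-before-last< (_ ∷ zs) (_ ∷ xs<m) e (s≤s lt) = entry-before-last< zs xs<m (∷-injectiveʳ e) lt

red≢blue : ∀ ts us → encode (red ∷ ts) ≢ encode (blue ∷ us)
red≢blue ts us e = <-irrefl (sym (encode-totalLen (red ∷ ts) (blue ∷ us) e))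
  (entry-before-last< [] (bounded (encode-IsP132 ts)) e
    (subst (0 <_) (sym (length≡ (encode-IsP132 ts))) z<s))

red≢domino : ∀ ts us → encode (red ∷ ts) ≢ encode (domino ∷ us)
red≢domino ts us e = <-irrefl (sym same-total)
  (entry-before-last< (_ ∷ []) (bounded (encode-IsP132 ts)) e
    (subst (1 <_) (sym (trans (length≡ (encode-IsP132 ts)) same-total)) (s≤s z<s)))
  where
  same-total = encode-totalLen (red ∷ ts) (domino ∷ us) e

blue≢domino : ∀ ts us → encode (blue ∷ ts) ≢ encode (domino ∷ us)
blue≢domino ts us e =
  1+n≢n (suc-injective (trans (sym (encode-totalLen (blue ∷ ts) (domino ∷ us) e)) (∷-injectiveˡ e)))

encode-head-injective : ∀ t u ts us → encode (t ∷ ts) ≡ encode (u ∷ us) → t ≡ u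
encode-head-injective red    red    _  _  _ = refl
encode-head-injective blue   blue   _  _  _ = refl
encode-head-injective domino domino _  _  _ = refl
encode-head-injective red    blue   ts us e = ⊥-elim (red≢blue ts us e)
encode-head-injective blue   red    ts us e = ⊥-elim (red≢blue us ts (sym e))
encode-head-injective red    domino ts us e = ⊥-elim (red≢domino ts us e)
encode-head-injective domino red    ts us e = ⊥-elim (red≢domino us ts (sym e))
encode-head-injective blue   domino ts us e = ⊥-elim (blue≢domino ts us e)
encode-head-injective domino blue   ts us e = ⊥-elim (blue≢domino us ts (sym e))

encode-tail-injective : ∀ t ts us → encode (t ∷ ts) ≡ encode (t ∷ us) → encode ts ≡ encode us
encode-tail-injective red    ts us e = ∷ʳ-injectiveˡ (encode ts) (encode us) e
encode-tail-injective blue   _  _  e = ∷-injectiveʳ e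
encode-tail-injective domino _  _  e = ∷-injectiveʳ (∷-injectiveʳ e)

encode-injective : ∀ ts us → encode ts ≡ encode us → ts ≡ us
encode-injective [] [] _ = refl
encode-injective [] (u ∷ us) e = ⊥-elim (totalLen-∷≢0 u us (sym (encode-totalLen [] (u ∷ us) e)))
encode-injective (t ∷ ts) [] e = ⊥-elim (totalLen-∷≢0 t ts (encode-totalLen (t ∷ ts) [] e))
encode-injective (t ∷ ts) (u ∷ us) e with refl ← encode-head-injective t u ts us e =
  cong (t ∷_) (encode-injective ts us (encode-tail-injective t ts us e))

isP132⇔ : ∀ {n} (v : Vec (Fin n) n) → T (isP132 v) ⇔ (Unique (oneLine v) × Avoiding (oneLine v))
isP132⇔ v = (distinct⇔Unique (oneLine v) ×-⇔ avoids⇔Avoiding (oneLine v)) ⇔-∘ T-∧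

vector-of-bounded : ∀ {k n} xs → length xs ≡ n → All (_< k) xs →
                    Σ[ v ∈ Vec (Fin k) n ] map toℕ (toList v) ≡ xs
vector-of-bounded [] refl [] = []ᵛ , refl
vector-of-bounded (x ∷ xs) refl (x<k ∷ xs<k) with v , eq ← vector-of-bounded xs refl xs<k =
  fromℕ< x<k ∷ᵛ v , cong₂ _∷_ (toℕ-fromℕ< x<k) eq

oneLine-injective : ∀ {n} (v w : Vec (Fin n) n) → oneLine v ≡ oneLine w → v ≡ w
oneLine-injective v w e =
  trans (sym (cast-is-id refl v)) (toList-injective refl v w (map-injective toℕ-injective e))

IsP132⇒P132 : ∀ {n xs} → IsP132 n xs → Σ[ π ∈ P132 n ] oneLine (proj₁ π) ≡ xs
IsP132⇒P132 p with v , refl ← vector-of-bounded _ (length≡ p) (bounded p) =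
  (v , Equivalence.from (isP132⇔ v) (unique p , avoiding p)) , refl

P132⇒IsP132 : ∀ {n} (π : P132 n) → IsP132 n (oneLine (proj₁ π))
P132⇒IsP132 (v , t) = record
  { length≡  = trans (length-map toℕ (toList v)) (length-toList v)
  ; bounded  = All.map⁺ (All.universal toℕ<n (toList v))
  ; unique   = proj₁ (Equivalence.to (isP132⇔ v) t)
  ; avoiding = proj₂ (Equivalence.to (isP132⇔ v) t)
  }

Σ-T-≡ : ∀ {A : Set} {P : A → Bool} {x y : Σ A (T ∘ P)} → proj₁ x ≡ proj₁ y → x ≡ y
Σ-T-≡ {x = a , p} {.a , q} refl = cong (a ,_) (T-irrelevant p q)

encode-tiling : ∀ m (x : Tiling m) → IsP132 (suc m) (encode (proj₁ x))
encode-tiling m (ts , t) = subst (λ k → IsP132 (suc k) (encode ts)) (≡ᵇ⇒≡ _ _ t) (encode-IsP132 ts)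

tilingToP132 : ∀ m → Tiling m → P132 (suc m)
tilingToP132 m x = proj₁ (IsP132⇒P132 (encode-tiling m x))

tilingToP132-oneLine : ∀ m x → oneLine (proj₁ (tilingToP132 m x)) ≡ encode (proj₁ x)
tilingToP132-oneLine m x = proj₂ (IsP132⇒P132 (encode-tiling m x))

tilingToP132-injective : ∀ m → Injective _≡_ _≡_ (tilingToP132 m)
tilingToP132-injective m {x} {y} e = Σ-T-≡ (encode-injective _ _ (begin
  encode (proj₁ x)                   ≡⟨ tilingToP132-oneLine m x ⟨
  oneLine (proj₁ (tilingToP132 m x)) ≡⟨ cong (oneLine ∘ proj₁) e ⟩
  oneLine (proj₁ (tilingToP132 m y)) ≡⟨ tilingToP132-oneLine m y ⟩
  encode (proj₁ y)                   ∎))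
  where open ≡-Reasoning

tilingToP132-surjective : ∀ m → Surjective _≡_ _≡_ (tilingToP132 m)
tilingToP132-surjective m π with ts , refl , e ← encode-surjective m (P132⇒IsP132 π) =
  let x = ts , ≡⇒≡ᵇ m m refl
  in x , λ { refl → Σ-T-≡ (oneLine-injective _ _ (trans (tilingToP132-oneLine m x) e)) }

mainTheorem3 : (n : ℕ) → n ≥ 1 → P132 n ⤖ Tiling (n ∸ 1)
mainTheorem3 (suc m) _ = ⤖-sym (mk⤖ (tilingToP132-injective m , tilingToP132-surjective m))
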